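{- Let $H=(V,E)$ be a connected hypergraph without empty edges. Then: (1) The intersection of any two distinct blocks of $H$ contains no edges and at most one vertex. (2) The blocks of $H$ form a decomposition of $H$ (every edge of $H$ lies in exactly one block and $H$ is the union of its blocks). (3) For any cycle $C$ of $H$, the hypersubgraph $\mathcal{H}(C)$ associated with $C$ is contained within a block of $H$.
   Context: A hypergraph $H=(V,E)$ consists of a nonempty finite vertex set $V$, a finite edge set $E$, and an incidence function $\psi:E\to 2^V$; edges are identified with their vertex sets (parallel edges allowed); an empty edge has empty vertex set. Two distinct vertices are adjacent via $e$ if both lie in $e$; a walk is a sequence $v_0e_1v_1\dots e_kv_k$ with $v_{i-1},v_i$ adjacent via $e_i$; $H$ is connected if any two distinct vertices are joined by a walk. A cycle is a walk $v_0e_1v_1\dots e_kv_k$ with $k\ge2$, $v_0=v_k$, $v_0,\dots,v_{k-1}$ pairwise distinct and $e_1,\dots,e_k$ pairwise distinct; $\mathcal{H}(C)$ is the hypersubgraph with edge set $\{e_1,\dots,e_k\}$ and vertex set $e_1\cup\dots\cup e_k$. A hypersubgraph of $H$ is a hypergraph $(V',E')$ with $\emptyset\ne V'\subseteq V$, $E'\subseteq E$. A vertex $v$ is a separating vertex of a connected hypergraph $K$ without empty edges if there are two connected hypersubgraphs $K_1,K_2$ of $K$, each with at least one edge, with $E(K_1)\cap E(K_2)=\emptyset$, $V(K)=V(K_1)\cup V(K_2)$, $E(K)=E(K_1)\cup E(K_2)$, and $V(K_1)\cap V(K_2)=\{v\}$. A hypergraph is non-separable if it is connected, has no empty edges and has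 no separating vertices. A block of $H$ is a maximal non-separable hypersubgraph of $H$. -}

module Defs where

open import Data.Nat using (ℕ; suc; _≤_)
open import Data.Fin using (Fin; zero; inject₁; fromℕ)
open import Data.Fin.Subset using (Subset; _∈_; _⊆_; _∩_; _∪_; ⁅_⁆; Nonempty)
  renaming (⊥ to ∅)
open import Data.Product using (Σ; ∃; _×_; _,_; proj₁; proj₂)
open import Relation.Binary.PropositionalEquality using (_≡_; _≢_)
open import Relation.Nullary using (¬_)

-- A hypergraph on vertex set Fin n with edge set Fin m is given by its
-- incidence function ψ : Fin m → Subset n (parallel / empty edges allowed).
Incidence : ℕ → ℕ → Set
Incidence n m = Fin m → Subset n

Sub : ℕ → ℕ → Set
Sub n m = Subset n × Subset m

VS : ∀ {n m} → Sub n m → Subset n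
VS = proj₁

ES : ∀ {n m} → Sub n m → Subset m
ES = proj₂

module _ {n m : ℕ} (ψ : Incidence n m) where

  IsHypersubgraph : Sub n m → Set
  IsHypersubgraph K = Nonempty (VS K) × (∀ e → e ∈ ES K → ψ e ⊆ VS K)

  IsHypersubgraphOf : Sub n m → Sub n m → Set
  IsHypersubgraphOf K' K = IsHypersubgraph K' × (VS K' ⊆ VS K) × (ES K' ⊆ ES K)

  -- A walk v₀ e₁ v₁ … e_k v_k: vertices indexed by Fin (suc k), edges by Fin k;
  -- the edge es i joins the distinct vertices vs (inject₁ i) and vs (suc i).
  record Walk : Set where
    field
      len : ℕ
      vs  : Fin (suc len) → Fin n
      es  : Fin len → Fin m
      adj : ∀ (i : Fin len) →
              (vs (inject₁ i) ≢ vs (Fin.suc i))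
              × (vs (inject₁ i) ∈ ψ (es i))
              × (vs (Fin.suc i) ∈ ψ (es i))

  open Walk public

  Connected : Sub n m → Set
  Connected K = ∀ u v → u ∈ VS K → v ∈ VS K → u ≢ v →
    Σ Walk λ w → (vs w zero ≡ u) × (vs w (fromℕ (len w)) ≡ v)
                 × (∀ i → es w i ∈ ES K)

  NoEmptyEdges : Sub n m → Set
  NoEmptyEdges K = ∀ e → e ∈ ES K → Nonempty (ψ e)

  HasEdge : Sub n m → Set
  HasEdge K = Nonempty (ES K)

  SeparatingVertex : Sub n m → Fin n → Set
  SeparatingVertex K v = Σ (Sub n m) λ K₁ → Σ (Sub n m) λ K₂ →
      IsHypersubgraphOf K₁ K × IsHypersubgraphOf K₂ K
    × Connected K₁ × Connected K₂
    × HasEdge K₁ × HasEdge K₂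
    × (ES K₁ ∩ ES K₂ ≡ ∅)
    × (VS K ≡ VS K₁ ∪ VS K₂)
    × (ES K ≡ ES K₁ ∪ ES K₂)
    × (VS K₁ ∩ VS K₂ ≡ ⁅ v ⁆)

  NonSeparable : Sub n m → Set
  NonSeparable K = Connected K × NoEmptyEdges K × (∀ v → ¬ SeparatingVertex K v)

  IsBlock : Sub n m → Set
  IsBlock B = IsHypersubgraph B × NonSeparable B
    × (∀ K → IsHypersubgraph K → VS B ⊆ VS K → ES B ⊆ ES K → NonSeparable K
         → (VS K ⊆ VS B) × (ES K ⊆ ES B))

  IsCycle : Walk → Set
  IsCycle w = (2 ≤ len w)
    × (vs w zero ≡ vs w (fromℕ (len w)))
    × (∀ i j → vs w (inject₁ i) ≡ vs w (inject₁ j) → i ≡ j)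
    × (∀ i j → es w i ≡ es w j → i ≡ j)

  -- ℋ(C) is contained in B: every edge of C is an edge of B and every vertex
  -- of ℋ(C) (= union of the edges of C) is a vertex of B.
  CycleContainedIn : Walk → Sub n m → Set
  CycleContainedIn w B = ∀ i → (es w i ∈ ES B) × (ψ (es w i) ⊆ VS B)

-- If v separates K into K₁ and K₂, a non-separable hypersubgraph of K has all its edges on one side:
-- otherwise its intersections with K₁ and K₂ would separate it at v. Hence the union of two
-- non-separable hypersubgraphs sharing an edge, or sharing two vertices, is again non-separable, and
-- maximality of blocks gives (1) and the uniqueness in (2). A single vertex, a single edge and the
-- hypersubgraph of a cycle are non-separable (a cycle crosses between the two sides twice, both times
-- at v, which it visits only once), and every non-separable hypersubgraph extends to a block by a
-- finite search, all notions involved being decidable.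
module Submission where

open import Defs
open import Level using (Level)
open import Data.Nat using (ℕ; zero; suc; _≤_; _<_; _+_; z≤n; s≤s; s≤s⁻¹)
open import Data.Nat.Properties
  using ( ≤-trans; <-≤-trans; ≤-reflexive; ≤-refl; +-mono-≤; +-mono-≤-<; +-mono-<-≤; +-suc; +-identityʳ
        ; <⇒≱; n≮0; m≤n+m)
open import Data.Fin using (Fin; zero; suc; inject₁; fromℕ; _≟_)
open import Data.Fin.Properties using (any?; all?)
open import Data.Fin.Induction using (<-weakInduction; >-weakInduction)
open import Data.Fin.Subset
  using (Subset; _∈_; _∉_; _⊆_; _∩_; _∪_; _-_; ⁅_⁆; Nonempty; Empty; ∣_∣; ⊤) renaming (⊥ to ∅)
open import Data.Fin.Subset.Properties
open import Data.Vec using (tabulate)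
open import Data.Vec.Properties using (lookup∘tabulate; []=⇒lookup; lookup⇒[]=; ≡-dec)
import Data.Bool.Properties as Bool
open import Data.Product using (Σ; ∃; ∃₂; _×_; _,_; proj₁; proj₂)
open import Data.Sum as ⊎ using (_⊎_; inj₁; inj₂; [_,_]′; swap)
open import Data.Empty using (⊥; ⊥-elim)
open import Function using (id; _∘_)
open import Relation.Nullary using (¬_; Dec; yes; no; does)
open import Relation.Nullary.Decidable
  using (_×-dec_; _⊎-dec_; _→-dec_; ¬?; map′; dec-true; decidable-stable)
open import Relation.Unary using (Pred; Decidable)
open import Relation.Binary.PropositionalEquality
  using (_≡_; _≢_; refl; sym; trans; cong; cong₂; subst; subst₂)

module _ {ℓ : Level} {k : ℕ} {P : Pred (Fin k) ℓ} (P? : Decidable P) where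

  comprehension : Subset k
  comprehension = tabulate (λ x → does (P? x))

  ∈-comprehension⁺ : ∀ {x} → P x → x ∈ comprehension
  ∈-comprehension⁺ {x} px = lookup⇒[]= x _ (trans (lookup∘tabulate _ x) (dec-true (P? x) px))

  ∈-comprehension⁻ : ∀ {x} → x ∈ comprehension → P x
  ∈-comprehension⁻ {x} x∈
    with P? x | trans (sym (lookup∘tabulate (λ y → does (P? y)) x)) ([]=⇒lookup x∈)
  ... | yes px | _ = px
  ... | no _   | ()

infix 4 _≟ₛ_

_≟ₛ_ : ∀ {k} (p q : Subset k) → Dec (p ≡ q)
_≟ₛ_ = ≡-dec Bool._≟_

p≡⁅x⁆ : ∀ {k} {p : Subset k} {x} → x ∈ p → (∀ {y} → y ∈ p → y ≡ x) → p ≡ ⁅ x ⁆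
p≡⁅x⁆ {x = x} x∈p unique =
  ⊆-antisym (λ y∈p → subst (_∈ ⁅ x ⁆) (sym (unique y∈p)) (x∈⁅x⁆ x))
            (λ y∈⁅x⁆ → subst (_∈ _) (sym (x∈⁅y⁆⇒x≡y x y∈⁅x⁆)) x∈p)

∣p∣≤1 : ∀ {k} (p : Subset k) → (∀ {x y} → x ∈ p → y ∈ p → x ≡ y) → ∣ p ∣ ≤ 1
∣p∣≤1 {k} p unique with nonempty? p
... | yes (x , x∈p) = ≤-reflexive (trans (cong ∣_∣ (p≡⁅x⁆ x∈p (sym ∘ unique x∈p))) (∣⁅x⁆∣≡1 x))
... | no p-empty = ≤-trans (≤-reflexive (trans (cong ∣_∣ (Empty-unique p-empty)) (∣⊥∣≡0 k))) z≤n

p⊆q∪r⇒p≡p∩q∪p∩r : ∀ {k} {p q r : Subset k} → p ⊆ q ∪ r → p ≡ (p ∩ q) ∪ (p ∩ r)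
p⊆q∪r⇒p≡p∩q∪p∩r {p = p} {q} {r} p⊆q∪r = ⊆-antisym
  (λ x∈p → x∈p∪q⁺ (⊎.map (x∈p∩q⁺ ∘ (x∈p ,_)) (x∈p∩q⁺ ∘ (x∈p ,_)) (x∈p∪q⁻ q r (p⊆q∪r x∈p))))
  (λ x∈ → [ p∩q⊆p p q , p∩q⊆p p r ]′ (x∈p∪q⁻ _ _ x∈))

p⊈q⇒∃x∈p∖q : ∀ {k} {p q : Subset k} → ¬ p ⊆ q → ∃ λ x → x ∈ p × x ∉ q
p⊈q⇒∃x∈p∖q {p = p} {q} p⊈q with any? (λ x → (x ∈? p) ×-dec ¬? (x ∈? q))
... | yes w = w
... | no none = ⊥-elim (p⊈q λ {x} x∈p → decidable-stable (x ∈? q) λ x∉q → none (x , x∈p , x∉q))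

prev : ∀ {k} → Fin (suc k) → Fin (suc k)
prev {k} zero = fromℕ k
prev (suc i) = inject₁ i

prev-closed⇒constant : ∀ {ℓ k} (P : Pred (Fin (suc k)) ℓ) → (∀ i → P i → P (prev i)) →
  ∀ {i} j → P i → P j
prev-closed⇒constant P closed {i} j Pi =
  >-weakInduction P (closed zero (toZero i Pi)) (λ i → closed (suc i)) j
  where
  toZero : ∀ i → P i → P zero
  toZero = <-weakInduction (λ i → P i → P zero) id (λ i toZero′ → toZero′ ∘ closed (suc i))

cyclic-boundary : ∀ {ℓ k} {P : Pred (Fin (suc k)) ℓ} → Decidable P →
  ∀ {i j} → P i → ¬ P j → ∃ λ p → P p × ¬ P (prev p)
cyclic-boundary {P = P} P? {j = j} Pi ¬Pj with any? (λ p → P? p ×-dec ¬? (P? (prev p)))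
... | yes boundary = boundary
... | no no-boundary = ⊥-elim (¬Pj (prev-closed⇒constant P closed j Pi))
  where
  closed : ∀ p → P p → P (prev p)
  closed p Pp = decidable-stable (P? (prev p)) (λ ¬Pprev → no-boundary (p , Pp , ¬Pprev))

module _ {N m : ℕ} where

  infix 4 _⊑_ _⊑?_

  _⊑_ : Sub N m → Sub N m → Set
  K ⊑ L = VS K ⊆ VS L × ES K ⊆ ES L

  _⊑?_ : ∀ K L → Dec (K ⊑ L)
  K ⊑? L = (VS K ⊆? VS L) ×-dec (ES K ⊆? ES L)

  ⊑-trans : ∀ {K L M} → K ⊑ L → L ⊑ M → K ⊑ M
  ⊑-trans (VK⊆VL , EK⊆EL) (VL⊆VM , EL⊆EM) = VL⊆VM ∘ VK⊆VL , EL⊆EM ∘ EK⊆EL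

  ⊑-antisym : ∀ {K L} → K ⊑ L → L ⊑ K → K ≡ L
  ⊑-antisym (VK⊆VL , EK⊆EL) (VL⊆VK , EL⊆EK) = cong₂ _,_ (⊆-antisym VK⊆VL VL⊆VK) (⊆-antisym EK⊆EL EL⊆EK)

  anySub? : ∀ {ℓ} {P : Pred (Sub N m) ℓ} → Decidable P → Dec (∃ P)
  anySub? P? = map′ (λ (V , E , p) → (V , E) , p) (λ ((V , E) , p) → V , E , p)
                 (anySubset? λ V → anySubset? λ E → P? (V , E))

  size : Sub N m → ℕ
  size K = ∣ VS K ∣ + ∣ ES K ∣

  size≤ : ∀ K → size K ≤ N + m
  size≤ K = +-mono-≤ (∣p∣≤n (VS K)) (∣p∣≤n (ES K))

  ⊏⇒size< : ∀ {K L} → K ⊑ L → ¬ L ⊑ K → size K < size L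
  ⊏⇒size< {K} {L} (VK⊆VL , EK⊆EL) L⋢K with VS L ⊆? VS K | ES L ⊆? ES K
  ... | yes VL⊆VK | yes EL⊆EK = ⊥-elim (L⋢K (VL⊆VK , EL⊆EK))
  ... | no VL⊈VK  | _ = +-mono-<-≤ (p⊂q⇒∣p∣<∣q∣ (VK⊆VL , p⊈q⇒∃x∈p∖q VL⊈VK)) (p⊆q⇒∣p∣≤∣q∣ EK⊆EL)
  ... | yes _ | no EL⊈EK = +-mono-≤-< (p⊆q⇒∣p∣≤∣q∣ VK⊆VL) (p⊂q⇒∣p∣<∣q∣ (EK⊆EL , p⊈q⇒∃x∈p∖q EL⊈EK))

  module _ {ℓ} {P : Pred (Sub N m) ℓ} (P? : Decidable P) where

    MaximalAbove : Sub N m → Set ℓ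
    MaximalAbove K₀ = ∃ λ B → P B × K₀ ⊑ B × (∀ K → P K → B ⊑ K → K ⊑ B)

    maximal-above : ∀ {K₀} → P K₀ → MaximalAbove K₀
    maximal-above {K₀} PK₀ = climb (N + m) K₀ PK₀ (id , id) (m≤n+m (N + m) (size K₀))
      where
      climb : ∀ fuel B → P B → K₀ ⊑ B → N + m ≤ size B + fuel → MaximalAbove K₀
      climb fuel B PB K₀⊑B bound with anySub? (λ K → P? K ×-dec (B ⊑? K) ×-dec ¬? (K ⊑? B))
      ... | no none =
        B , PB , K₀⊑B , λ K PK B⊑K → decidable-stable (K ⊑? B) λ K⋢B → none (K , PK , B⊑K , K⋢B)
      climb zero B PB K₀⊑B bound | yes (K , PK , B⊑K , K⋢B) =
        ⊥-elim (<⇒≱ (<-≤-trans (⊏⇒size< B⊑K K⋢B) (size≤ K))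
                    (subst (N + m ≤_) (+-identityʳ (size B)) bound))
      climb (suc fuel) B PB K₀⊑B bound | yes (K , PK , B⊑K , K⋢B) =
        climb fuel K PK (⊑-trans K₀⊑B B⊑K)
          (≤-trans bound (≤-trans (≤-reflexive (+-suc (size B) fuel))
                                  (+-mono-≤ (⊏⇒size< B⊑K K⋢B) ≤-refl)))

module _ {N m : ℕ} (ψ : Incidence N m) where

  -- Unlike a Walk, a Reach may repeat a vertex in consecutive steps, which makes it closed under composition.
  data Reach (E : Subset m) : Fin N → Fin N → Set where
    stop : ∀ {u} → Reach E u u
    step : ∀ {u w v} e → e ∈ E → u ∈ ψ e → w ∈ ψ e → Reach E w v → Reach E u v

  Reach-trans : ∀ {E u w v} → Reach E u w → Reach E w v → Reach E u v
  Reach-trans stop q = q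
  Reach-trans (step e e∈E u∈e w∈e p) q = step e e∈E u∈e w∈e (Reach-trans p q)

  Reach-sym : ∀ {E u v} → Reach E u v → Reach E v u
  Reach-sym stop = stop
  Reach-sym (step e e∈E u∈e w∈e p) = Reach-trans (Reach-sym p) (step e e∈E w∈e u∈e stop)

  Reach-mono : ∀ {E E′ u v} → E ⊆ E′ → Reach E u v → Reach E′ u v
  Reach-mono E⊆E′ stop = stop
  Reach-mono E⊆E′ (step e e∈E u∈e w∈e p) = step e (E⊆E′ e∈E) u∈e w∈e (Reach-mono E⊆E′ p)

  Reach-closed : ∀ {E S u v} → (∀ e → e ∈ E → ψ e ⊆ S) → u ∈ S → Reach E u v → v ∈ S
  Reach-closed closed u∈S stop = u∈S
  Reach-closed closed u∈S (step e e∈E u∈e w∈e p) = Reach-closed closed (closed e e∈E w∈e) p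

  Reach-first-edge : ∀ {E u v} → Reach E u v → u ≢ v → ∃ λ e → e ∈ E × u ∈ ψ e
  Reach-first-edge stop u≢u = ⊥-elim (u≢u refl)
  Reach-first-edge (step e e∈E u∈e _ _) _ = e , e∈E , u∈e

  vs∈es : ∀ (W : Walk ψ) i → vs W (inject₁ i) ∈ ψ (es W i)
  vs∈es W i = proj₁ (proj₂ (adj W i))

  vs-suc∈es : ∀ (W : Walk ψ) i → vs W (suc i) ∈ ψ (es W i)
  vs-suc∈es W i = proj₂ (proj₂ (adj W i))

  Walk-in : Subset m → Fin N → Fin N → Set
  Walk-in E u v = Σ (Walk ψ) λ w → (vs w zero ≡ u) × (vs w (fromℕ (len w)) ≡ v) × (∀ i → es w i ∈ E)

  cons-walk : ∀ {E u w v} e → e ∈ E → u ≢ w → u ∈ ψ e → w ∈ ψ e → Walk-in E w v → Walk-in E u v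
  cons-walk {u = u} e e∈E u≢w u∈e w∈e (W , start , end , W⊆E) =
    record { len = suc (len W) ; vs = vs′ ; es = es′ ; adj = adj′ } , refl , end , es′⊆E
    where
    vs′ : Fin (suc (suc (len W))) → _
    vs′ zero = u
    vs′ (suc i) = vs W i
    es′ : Fin (suc (len W)) → Fin m
    es′ zero = e
    es′ (suc i) = es W i
    adj′ : ∀ i → (vs′ (inject₁ i) ≢ vs′ (suc i)) × (vs′ (inject₁ i) ∈ ψ (es′ i)) × (vs′ (suc i) ∈ ψ (es′ i))
    adj′ zero = (λ eq → u≢w (trans eq start)) , u∈e , subst (_∈ ψ e) (sym start) w∈e
    adj′ (suc i) = adj W i
    es′⊆E : ∀ i → es′ i ∈ _
    es′⊆E zero = e∈E
    es′⊆E (suc i) = W⊆E i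

  Reach⇒Walk : ∀ {E u v} → Reach E u v → Walk-in E u v
  Reach⇒Walk {u = u} stop = record { len = 0 ; vs = λ _ → u ; es = λ () ; adj = λ () } , refl , refl , λ ()
  Reach⇒Walk (step {u} {w} e e∈E u∈e w∈e p) with u ≟ w
  ... | yes refl = Reach⇒Walk p
  ... | no u≢w = cons-walk e e∈E u≢w u∈e w∈e (Reach⇒Walk p)

  Walk⇒Reach : ∀ {E} (W : Walk ψ) → (∀ i → es W i ∈ E) → ∀ j → Reach E (vs W zero) (vs W j)
  Walk⇒Reach W W⊆E = <-weakInduction (λ j → Reach _ (vs W zero) (vs W j)) stop
    λ i p → Reach-trans p (step (es W i) (W⊆E i) (vs∈es W i) (vs-suc∈es W i) stop)

  Connected⇒Reach : ∀ {K} → Connected ψ K → ∀ {u v} → u ∈ VS K → v ∈ VS K → Reach (ES K) u v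
  Connected⇒Reach conn {u} {v} u∈K v∈K with u ≟ v
  ... | yes refl = stop
  ... | no u≢v with conn u v u∈K v∈K u≢v
  ... | W , start , end , W⊆K = subst₂ (Reach _) start end (Walk⇒Reach W W⊆K (fromℕ (len W)))

  Reach⇒Connected : ∀ {K} → (∀ {u v} → u ∈ VS K → v ∈ VS K → Reach (ES K) u v) → Connected ψ K
  Reach⇒Connected reach u v u∈K v∈K _ = Reach⇒Walk (reach u∈K v∈K)

  Reach-without-edges : ∀ {E u v} → Empty E → Reach E u v → u ≡ v
  Reach-without-edges E-empty stop = refl
  Reach-without-edges E-empty (step e e∈E _ _ _) = ⊥-elim (E-empty (e , e∈E))

  ThroughEdge : Subset m → Fin m → Fin N → Fin N → Set
  ThroughEdge E e u v = ∃₂ λ a b → a ∈ ψ e × b ∈ ψ e × Reach E u a × Reach E b v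

  -- Cut a walk at the first and the last use of e.
  Reach-split : ∀ {E u v} e → Reach E u v → Reach (E - e) u v ⊎ ThroughEdge (E - e) e u v
  Reach-split e stop = inj₁ stop
  Reach-split e (step f f∈E u∈f w∈f p) with f ≟ e | Reach-split e p
  ... | yes refl | inj₁ p′ = inj₂ (_ , _ , u∈f , w∈f , stop , p′)
  ... | yes refl | inj₂ (_ , b , _ , b∈e , _ , p′) = inj₂ (_ , b , u∈f , b∈e , stop , p′)
  ... | no f≢e | inj₁ p′ = inj₁ (step f (x∈p∧x≢y⇒x∈p-y f∈E f≢e) u∈f w∈f p′)
  ... | no f≢e | inj₂ (a , b , a∈e , b∈e , p₁ , p₂) =
    inj₂ (a , b , a∈e , b∈e , step f (x∈p∧x≢y⇒x∈p-y f∈E f≢e) u∈f w∈f p₁ , p₂)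

  Reach-join : ∀ {E u v e} → e ∈ E → Reach (E - e) u v ⊎ ThroughEdge (E - e) e u v → Reach E u v
  Reach-join {E} {e = e} e∈E = [ Reach-mono E-e⊆E , (λ (_ , _ , a∈e , b∈e , p₁ , p₂) →
      Reach-trans (Reach-mono E-e⊆E p₁) (step e e∈E a∈e b∈e (Reach-mono E-e⊆E p₂))) ]′
    where
    E-e⊆E : E - e ⊆ E
    E-e⊆E = p─q⊆p E ⁅ e ⁆

  Reach?-bounded : ∀ k E → ∣ E ∣ ≤ k → ∀ u v → Dec (Reach E u v)
  Reach?-bounded k E _ u v with nonempty? E
  Reach?-bounded k E _ u v | no E-empty = map′ (λ { refl → stop }) (Reach-without-edges E-empty) (u ≟ v)
  Reach?-bounded zero E ∣E∣≤0 u v | yes (e , e∈E) = ⊥-elim (n≮0 (<-≤-trans (x∈p⇒∣p-x∣<∣p∣ e∈E) ∣E∣≤0))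
  Reach?-bounded (suc k) E ∣E∣≤1+k u v | yes (e , e∈E) =
    map′ (Reach-join e∈E) (Reach-split e) (Reach? u v ⊎-dec through?)
    where
    Reach? : ∀ u v → Dec (Reach (E - e) u v)
    Reach? = Reach?-bounded k (E - e) (s≤s⁻¹ (<-≤-trans (x∈p⇒∣p-x∣<∣p∣ e∈E) ∣E∣≤1+k))
    through? : Dec (ThroughEdge (E - e) e u v)
    through? = any? λ a → any? λ b → (a ∈? ψ e) ×-dec (b ∈? ψ e) ×-dec Reach? u a ×-dec Reach? b v

  Reach? : ∀ E u v → Dec (Reach E u v)
  Reach? E = Reach?-bounded m E (∣p∣≤n E)

  Connected? : ∀ K → Dec (Connected ψ K)
  Connected? K = map′ (λ reach → Reach⇒Connected (reach _ _)) (λ conn u v → Connected⇒Reach conn)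
    (all? λ u → all? λ v → (u ∈? VS K) →-dec (v ∈? VS K) →-dec Reach? (ES K) u v)

  IsHypersubgraph? : ∀ K → Dec (IsHypersubgraph ψ K)
  IsHypersubgraph? K = nonempty? (VS K) ×-dec (all? λ e → (e ∈? ES K) →-dec (ψ e ⊆? VS K))

  IsHypersubgraphOf? : ∀ K′ K → Dec (IsHypersubgraphOf ψ K′ K)
  IsHypersubgraphOf? K′ K = IsHypersubgraph? K′ ×-dec (VS K′ ⊆? VS K) ×-dec (ES K′ ⊆? ES K)

  NoEmptyEdges? : ∀ K → Dec (NoEmptyEdges ψ K)
  NoEmptyEdges? K = all? λ e → (e ∈? ES K) →-dec nonempty? (ψ e)

  SeparatingVertex? : ∀ K v → Dec (SeparatingVertex ψ K v)
  SeparatingVertex? K v = anySub? λ K₁ → anySub? λ K₂ →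
    IsHypersubgraphOf? K₁ K ×-dec IsHypersubgraphOf? K₂ K ×-dec Connected? K₁ ×-dec Connected? K₂
    ×-dec nonempty? (ES K₁) ×-dec nonempty? (ES K₂)
    ×-dec (ES K₁ ∩ ES K₂ ≟ₛ ∅) ×-dec (VS K ≟ₛ VS K₁ ∪ VS K₂)
    ×-dec (ES K ≟ₛ ES K₁ ∪ ES K₂) ×-dec (VS K₁ ∩ VS K₂ ≟ₛ ⁅ v ⁆)

  NonSeparable? : ∀ K → Dec (NonSeparable ψ K)
  NonSeparable? K = Connected? K ×-dec NoEmptyEdges? K ×-dec all? (λ v → ¬? (SeparatingVertex? K v))

  -- The content of a separating vertex, minus the connectedness of the two parts.
  record Separation (K : Sub N m) (v : Fin N) (K₁ K₂ : Sub N m) : Set where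
    field
      closed₁ : ∀ e → e ∈ ES K₁ → ψ e ⊆ VS K₁
      closed₂ : ∀ e → e ∈ ES K₂ → ψ e ⊆ VS K₂
      edge₁ : HasEdge ψ K₁
      edge₂ : HasEdge ψ K₂
      edges-disjoint : ∀ {e} → e ∈ ES K₁ → e ∈ ES K₂ → ⊥
      vertex-cover : ∀ {x} → x ∈ VS K → x ∈ VS K₁ ⊎ x ∈ VS K₂
      edge-cover : ∀ {e} → e ∈ ES K → e ∈ ES K₁ ⊎ e ∈ ES K₂
      meet : ∀ {x} → x ∈ VS K₁ → x ∈ VS K₂ → x ≡ v
      v∈₁ : v ∈ VS K₁
      v∈₂ : v ∈ VS K₂
      edges₁⊆ : ES K₁ ⊆ ES K
      edges₂⊆ : ES K₂ ⊆ ES K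

    meet-at-edges : ∀ {e f x} → e ∈ ES K₁ → f ∈ ES K₂ → x ∈ ψ e → x ∈ ψ f → x ≡ v
    meet-at-edges e∈₁ f∈₂ x∈e x∈f = meet (closed₁ _ e∈₁ x∈e) (closed₂ _ f∈₂ x∈f)

    edges-not-all-on-side₁ : ¬ ES K ⊆ ES K₁
    edges-not-all-on-side₁ EK⊆E₁ = edges-disjoint (EK⊆E₁ (edges₂⊆ (proj₂ edge₂))) (proj₂ edge₂)

  open Separation

  Separation-swap : ∀ {K v K₁ K₂} → Separation K v K₁ K₂ → Separation K v K₂ K₁
  Separation-swap S = record
    { closed₁ = closed₂ S ; closed₂ = closed₁ S ; edge₁ = edge₂ S ; edge₂ = edge₁ S
    ; edges-disjoint = λ e∈₂ e∈₁ → edges-disjoint S e∈₁ e∈₂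
    ; vertex-cover = swap ∘ vertex-cover S ; edge-cover = swap ∘ edge-cover S
    ; meet = λ x∈₂ x∈₁ → meet S x∈₁ x∈₂ ; v∈₁ = v∈₂ S ; v∈₂ = v∈₁ S
    ; edges₁⊆ = edges₂⊆ S ; edges₂⊆ = edges₁⊆ S }

  separation : ∀ {K v} (s : SeparatingVertex ψ K v) → Separation K v (proj₁ s) (proj₁ (proj₂ s))
  separation {K} {v} (K₁ , K₂ , (hs₁ , _ , E₁⊆) , (hs₂ , _ , E₂⊆) , _ , _ , e₁ , e₂
                     , E-disj , V-cover , E-cover , V-meet) =
    record
    { closed₁ = proj₂ hs₁ ; closed₂ = proj₂ hs₂ ; edge₁ = e₁ ; edge₂ = e₂
    ; edges-disjoint = λ e∈₁ e∈₂ → ∉⊥ (subst (_ ∈_) E-disj (x∈p∩q⁺ (e∈₁ , e∈₂)))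
    ; vertex-cover = λ x∈K → x∈p∪q⁻ _ _ (subst (_ ∈_) V-cover x∈K)
    ; edge-cover = λ e∈K → x∈p∪q⁻ _ _ (subst (_ ∈_) E-cover e∈K)
    ; meet = λ x∈₁ x∈₂ → x∈⁅y⁆⇒x≡y v (subst (_ ∈_) V-meet (x∈p∩q⁺ (x∈₁ , x∈₂)))
    ; v∈₁ = proj₁ v∈₁∩₂ ; v∈₂ = proj₂ v∈₁∩₂
    ; edges₁⊆ = E₁⊆ ; edges₂⊆ = E₂⊆ }
    where
    v∈₁∩₂ : v ∈ VS K₁ × v ∈ VS K₂
    v∈₁∩₂ = x∈p∩q⁻ _ _ (subst (v ∈_) (sym V-meet) (x∈⁅x⁆ v))

  no-separating-vertex : ∀ {K e} → e ∈ ES K →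
    (∀ {v K₁ K₂} → Separation K v K₁ K₂ → e ∈ ES K₁ → ⊥) → ∀ v → ¬ SeparatingVertex ψ K v
  no-separating-vertex e∈K refute v s with edge-cover (separation s) e∈K
  ... | inj₁ e∈₁ = refute (separation s) e∈₁
  ... | inj₂ e∈₂ = refute (Separation-swap (separation s)) e∈₂

  module _ {K v K₁ K₂} (S : Separation K v K₁ K₂) {E : Subset m} (E⊆K : E ⊆ ES K) where

    -- Until it first leaves the vertices of K₁, a walk from K₁ uses only edges of K₁;
    -- it can only leave through v.
    Side₁ : Fin N → Fin N → Set
    Side₁ x z = (z ∈ VS K₁ × Reach (E ∩ ES K₁) x z) ⊎ (z ∉ VS K₁ × Reach (E ∩ ES K₁) x v)

    Side₁-through-v : ∀ {x z e} → e ∈ ES K₂ → z ∈ ψ e → Reach (E ∩ ES K₁) x v → Side₁ x z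
    Side₁-through-v {x} {z} {e} e∈₂ z∈e p with z ∈? VS K₁
    ... | yes z∈₁ = inj₁ (z∈₁ , subst (Reach _ x) (sym (meet S z∈₁ (closed₂ S e e∈₂ z∈e))) p)
    ... | no z∉₁ = inj₂ (z∉₁ , p)

    Side₁-step : ∀ {x z z′} e → e ∈ E → z ∈ ψ e → z′ ∈ ψ e → Side₁ x z → Side₁ x z′
    Side₁-step {x} e e∈E z∈e z′∈e side with edge-cover S (E⊆K e∈E) | side
    ... | inj₁ e∈₁ | inj₁ (_ , p) =
      inj₁ (closed₁ S e e∈₁ z′∈e , Reach-trans p (step e (x∈p∩q⁺ (e∈E , e∈₁)) z∈e z′∈e stop))
    ... | inj₁ e∈₁ | inj₂ (z∉₁ , _) = ⊥-elim (z∉₁ (closed₁ S e e∈₁ z∈e))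
    ... | inj₂ e∈₂ | inj₁ (z∈₁ , p) =
      Side₁-through-v e∈₂ z′∈e (subst (Reach _ x) (meet S z∈₁ (closed₂ S e e∈₂ z∈e)) p)
    ... | inj₂ e∈₂ | inj₂ (_ , p) = Side₁-through-v e∈₂ z′∈e p

    Reach⇒Side₁ : ∀ {x y} → x ∈ VS K₁ → Reach E x y → Side₁ x y
    Reach⇒Side₁ x∈₁ = go (inj₁ (x∈₁ , stop))
      where
      go : ∀ {x z y} → Side₁ x z → Reach E z y → Side₁ x y
      go side stop = side
      go side (step e e∈E z∈e w∈e p) = go (Side₁-step e e∈E z∈e w∈e side) p

  _∩ₛ_ : Sub N m → Sub N m → Sub N m
  B ∩ₛ K = (VS B ∩ VS K , ES B ∩ ES K)

  ∩ₛ-hypersubgraphOf : ∀ {B K} → IsHypersubgraph ψ B → (∀ e → e ∈ ES K → ψ e ⊆ VS K) →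
    Nonempty (VS B ∩ VS K) → IsHypersubgraphOf ψ (B ∩ₛ K) B
  ∩ₛ-hypersubgraphOf {B} {K} (_ , B-closed) K-closed nonempty =
    (nonempty , λ e e∈ x∈e → x∈p∩q⁺ (B-closed e (p∩q⊆p _ _ e∈) x∈e , K-closed e (p∩q⊆q _ _ e∈) x∈e))
    , p∩q⊆p _ _ , p∩q⊆p _ _

  ∩ₛ-side₁-connected : ∀ {B K v K₁ K₂} → IsHypersubgraphOf ψ B K → Connected ψ B →
    Separation K v K₁ K₂ → Connected ψ (B ∩ₛ K₁)
  ∩ₛ-side₁-connected (_ , _ , EB⊆EK) B-conn S = Reach⇒Connected λ u∈ w∈ →
    [ proj₂ , (λ (w∉₁ , _) → ⊥-elim (w∉₁ (p∩q⊆q _ _ w∈))) ]′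
      (Reach⇒Side₁ S EB⊆EK (p∩q⊆q _ _ u∈) (Connected⇒Reach B-conn (p∩q⊆p _ _ u∈) (p∩q⊆p _ _ w∈)))

  module _ {B K v K₁ K₂} (B⊆K : IsHypersubgraphOf ψ B K) (B-ns : NonSeparable ψ B) (S : Separation K v K₁ K₂)
           {e f} (e∈B : e ∈ ES B) (e∈₁ : e ∈ ES K₁) (f∈B : f ∈ ES B) (f∈₂ : f ∈ ES K₂) where

    private
      incident : ∀ {g} → g ∈ ES B → ∀ {x} → x ∈ ψ g → x ∈ VS B
      incident g∈B = proj₂ (proj₁ B⊆K) _ g∈B

    -- A walk in B from an end of e to an end of f has to pass from K₁ to K₂, hence through v.
    v∈B : v ∈ VS B
    v∈B with proj₁ (proj₂ B-ns) e e∈B | proj₁ (proj₂ B-ns) f f∈B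
    ... | x , x∈e | y , y∈f with Reach⇒Side₁ S (proj₂ (proj₂ B⊆K)) (closed₁ S e e∈₁ x∈e)
                                  (Connected⇒Reach (proj₁ B-ns) (incident e∈B x∈e) (incident f∈B y∈f))
    ... | inj₁ (y∈₁ , _) = subst (_∈ VS B) (meet S y∈₁ (closed₂ S f f∈₂ y∈f)) (incident f∈B y∈f)
    ... | inj₂ (_ , p) = Reach-closed (λ g g∈ → incident (p∩q⊆p _ _ g∈)) (incident e∈B x∈e) p

    separating-restriction : SeparatingVertex ψ B v
    separating-restriction =
      B ∩ₛ K₁ , B ∩ₛ K₂
      , ∩ₛ-hypersubgraphOf (proj₁ B⊆K) (closed₁ S) (v , x∈p∩q⁺ (v∈B , v∈₁ S))
      , ∩ₛ-hypersubgraphOf (proj₁ B⊆K) (closed₂ S) (v , x∈p∩q⁺ (v∈B , v∈₂ S))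
      , ∩ₛ-side₁-connected B⊆K (proj₁ B-ns) S , ∩ₛ-side₁-connected B⊆K (proj₁ B-ns) (Separation-swap S)
      , (e , x∈p∩q⁺ (e∈B , e∈₁)) , (f , x∈p∩q⁺ (f∈B , f∈₂))
      , Empty-unique (λ (g , g∈) →
          edges-disjoint S (p∩q⊆q _ _ (p∩q⊆p _ _ g∈)) (p∩q⊆q _ _ (p∩q⊆q _ _ g∈)))
      , p⊆q∪r⇒p≡p∩q∪p∩r (x∈p∪q⁺ ∘ vertex-cover S ∘ proj₁ (proj₂ B⊆K))
      , p⊆q∪r⇒p≡p∩q∪p∩r (x∈p∪q⁺ ∘ edge-cover S ∘ proj₂ (proj₂ B⊆K))
      , p≡⁅x⁆ (x∈p∩q⁺ (x∈p∩q⁺ (v∈B , v∈₁ S) , x∈p∩q⁺ (v∈B , v∈₂ S)))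
              (λ x∈ → meet S (p∩q⊆q _ _ (p∩q⊆p _ _ x∈)) (p∩q⊆q _ _ (p∩q⊆q _ _ x∈)))

  nonseparable-on-one-side : ∀ {B K v K₁ K₂} → IsHypersubgraphOf ψ B K → NonSeparable ψ B →
    Separation K v K₁ K₂ → ∀ {e} → e ∈ ES B → e ∈ ES K₁ → ES B ⊆ ES K₁
  nonseparable-on-one-side B⊆K B-ns S e∈B e∈₁ f∈B with edge-cover S (proj₂ (proj₂ B⊆K) f∈B)
  ... | inj₁ f∈₁ = f∈₁
  ... | inj₂ f∈₂ = ⊥-elim (proj₂ (proj₂ B-ns) _ (separating-restriction B⊆K B-ns S e∈B e∈₁ f∈B f∈₂))

  incident-edge : ∀ {B x y} → Connected ψ B → x ∈ VS B → y ∈ VS B → x ≢ y → ∃ λ e → e ∈ ES B × x ∈ ψ e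
  incident-edge B-conn x∈B y∈B = Reach-first-edge (Connected⇒Reach B-conn x∈B y∈B)

  _∪ₛ_ : Sub N m → Sub N m → Sub N m
  B₁ ∪ₛ B₂ = (VS B₁ ∪ VS B₂ , ES B₁ ∪ ES B₂)

  ∪ₛ-hypersubgraph : ∀ {B₁ B₂} → IsHypersubgraph ψ B₁ → IsHypersubgraph ψ B₂ → IsHypersubgraph ψ (B₁ ∪ₛ B₂)
  ∪ₛ-hypersubgraph ((x , x∈₁) , closed₁) (_ , closed₂) = (x , p⊆p∪q _ x∈₁)
    , λ e e∈ x∈e → [ (λ e∈₁ → p⊆p∪q _ (closed₁ e e∈₁ x∈e)) , (λ e∈₂ → q⊆p∪q _ _ (closed₂ e e∈₂ x∈e)) ]′
                     (x∈p∪q⁻ _ _ e∈)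

  module _ {B₁ B₂} (hs₁ : IsHypersubgraph ψ B₁) (ns₁ : NonSeparable ψ B₁)
                   (hs₂ : IsHypersubgraph ψ B₂) (ns₂ : NonSeparable ψ B₂) where

    private
      B₁⊆U : IsHypersubgraphOf ψ B₁ (B₁ ∪ₛ B₂)
      B₁⊆U = hs₁ , p⊆p∪q _ , p⊆p∪q _
      B₂⊆U : IsHypersubgraphOf ψ B₂ (B₁ ∪ₛ B₂)
      B₂⊆U = hs₂ , q⊆p∪q _ _ , q⊆p∪q _ _

      ∪ₛ-connected : ∀ {x} → x ∈ VS B₁ → x ∈ VS B₂ → Connected ψ (B₁ ∪ₛ B₂)
      ∪ₛ-connected {x} x∈₁ x∈₂ = Reach⇒Connected λ u∈ w∈ → Reach-trans (to-x u∈) (Reach-sym (to-x w∈))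
        where
        to-x : ∀ {u} → u ∈ VS (B₁ ∪ₛ B₂) → Reach (ES (B₁ ∪ₛ B₂)) u x
        to-x u∈ = [ (λ u∈₁ → Reach-mono (p⊆p∪q _) (Connected⇒Reach (proj₁ ns₁) u∈₁ x∈₁))
                  , (λ u∈₂ → Reach-mono (q⊆p∪q _ _) (Connected⇒Reach (proj₁ ns₂) u∈₂ x∈₂)) ]′
                  (x∈p∪q⁻ _ _ u∈)

      ∪ₛ-no-empty-edges : NoEmptyEdges ψ (B₁ ∪ₛ B₂)
      ∪ₛ-no-empty-edges e e∈ = [ proj₁ (proj₂ ns₁) e , proj₁ (proj₂ ns₂) e ]′ (x∈p∪q⁻ _ _ e∈)

      not-both-on-side₁ : ∀ {v K₁ K₂} → Separation (B₁ ∪ₛ B₂) v K₁ K₂ →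
        ∀ {e₁ e₂} → e₁ ∈ ES B₁ → e₁ ∈ ES K₁ → e₂ ∈ ES B₂ → e₂ ∈ ES K₁ → ⊥
      not-both-on-side₁ S e₁∈B₁ e₁∈K₁ e₂∈B₂ e₂∈K₁ = edges-not-all-on-side₁ S λ e∈ →
        [ nonseparable-on-one-side B₁⊆U ns₁ S e₁∈B₁ e₁∈K₁ , nonseparable-on-one-side B₂⊆U ns₂ S e₂∈B₂ e₂∈K₁ ]′
          (x∈p∪q⁻ _ _ e∈)

    ∪ₛ-nonseparable-sharing-edge : ∀ {e} → e ∈ ES B₁ → e ∈ ES B₂ → NonSeparable ψ (B₁ ∪ₛ B₂)
    ∪ₛ-nonseparable-sharing-edge {e} e∈B₁ e∈B₂ with proj₁ (proj₂ ns₁) e e∈B₁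
    ... | x , x∈e = ∪ₛ-connected (proj₂ hs₁ e e∈B₁ x∈e) (proj₂ hs₂ e e∈B₂ x∈e) , ∪ₛ-no-empty-edges
      , no-separating-vertex (p⊆p∪q _ e∈B₁) λ S e∈K₁ → not-both-on-side₁ S e∈B₁ e∈K₁ e∈B₂ e∈K₁

    -- If B₁ and B₂ lie on different sides, each of the two shared vertices is a vertex of
    -- both sides, i.e. equals v.
    ∪ₛ-nonseparable-sharing-two-vertices : ∀ {x y} → x ≢ y → x ∈ VS B₁ → x ∈ VS B₂ → y ∈ VS B₁ → y ∈ VS B₂ →
      NonSeparable ψ (B₁ ∪ₛ B₂)
    ∪ₛ-nonseparable-sharing-two-vertices {x} {y} x≢y x∈₁ x∈₂ y∈₁ y∈₂
      with incident-edge (proj₁ ns₁) x∈₁ y∈₁ x≢y | incident-edge (proj₁ ns₂) x∈₂ y∈₂ x≢y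
         | incident-edge (proj₁ ns₁) y∈₁ x∈₁ (x≢y ∘ sym) | incident-edge (proj₁ ns₂) y∈₂ x∈₂ (x≢y ∘ sym)
    ... | e₁ , e₁∈B₁ , x∈e₁ | e₂ , e₂∈B₂ , x∈e₂ | f₁ , f₁∈B₁ , y∈f₁ | f₂ , f₂∈B₂ , y∈f₂ =
      ∪ₛ-connected x∈₁ x∈₂ , ∪ₛ-no-empty-edges , no-separating-vertex (p⊆p∪q _ e₁∈B₁) different-sides
      where
      different-sides : ∀ {v K₁ K₂} → Separation (B₁ ∪ₛ B₂) v K₁ K₂ → e₁ ∈ ES K₁ → ⊥
      different-sides {K₁ = K₁} {K₂} S e₁∈K₁ with edge-cover S (q⊆p∪q _ _ e₂∈B₂)
      ... | inj₁ e₂∈K₁ = not-both-on-side₁ S e₁∈B₁ e₁∈K₁ e₂∈B₂ e₂∈K₁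
      ... | inj₂ e₂∈K₂ = x≢y (trans (meet-at-edges S e₁∈K₁ e₂∈K₂ x∈e₁ x∈e₂)
                                    (sym (meet-at-edges S (B₁-side₁ f₁∈B₁) (B₂-side₂ f₂∈B₂) y∈f₁ y∈f₂)))
        where
        B₁-side₁ : ES B₁ ⊆ ES K₁
        B₁-side₁ = nonseparable-on-one-side B₁⊆U ns₁ S e₁∈B₁ e₁∈K₁
        B₂-side₂ : ES B₂ ⊆ ES K₂
        B₂-side₂ = nonseparable-on-one-side B₂⊆U ns₂ (Separation-swap S) e₂∈B₂ e₂∈K₂

  vertex-sub : Fin N → Sub N m
  vertex-sub v = (⁅ v ⁆ , ∅)

  vertex-sub-hypersubgraph : ∀ v → IsHypersubgraph ψ (vertex-sub v)
  vertex-sub-hypersubgraph v = (v , x∈⁅x⁆ v) , λ e e∈∅ → ⊥-elim (∉⊥ e∈∅)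

  vertex-sub-nonseparable : ∀ v → NonSeparable ψ (vertex-sub v)
  vertex-sub-nonseparable v =
    Reach⇒Connected (λ u∈ w∈ → subst (Reach ∅ _) (trans (x∈⁅y⁆⇒x≡y v u∈) (sym (x∈⁅y⁆⇒x≡y v w∈))) stop)
    , (λ e e∈∅ → ⊥-elim (∉⊥ e∈∅))
    , λ _ s → ∉⊥ (edges₁⊆ (separation s) (proj₂ (edge₁ (separation s))))

  edge-sub : Fin m → Sub N m
  edge-sub e = (ψ e , ⁅ e ⁆)

  edge-sub-hypersubgraph : ∀ {e} → Nonempty (ψ e) → IsHypersubgraph ψ (edge-sub e)
  edge-sub-hypersubgraph {e} e-nonempty =
    e-nonempty , λ f f∈ → subst (λ g → ψ g ⊆ ψ e) (sym (x∈⁅y⁆⇒x≡y e f∈)) id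

  edge-sub-nonseparable : ∀ {e} → Nonempty (ψ e) → NonSeparable ψ (edge-sub e)
  edge-sub-nonseparable {e} e-nonempty =
    Reach⇒Connected (λ u∈e w∈e → step e (x∈⁅x⁆ e) u∈e w∈e stop)
    , (λ f f∈ → subst (Nonempty ∘ ψ) (sym (x∈⁅y⁆⇒x≡y e f∈)) e-nonempty)
    , no-separating-vertex (x∈⁅x⁆ e) λ S e∈K₁ →
        edges-disjoint S e∈K₁ (subst (_∈ _) (x∈⁅y⁆⇒x≡y e (edges₂⊆ S (proj₂ (edge₂ S)))) (proj₂ (edge₂ S)))

  visits? : ∀ (W : Walk ψ) x → Dec (∃ λ i → x ∈ ψ (es W i))
  visits? W x = any? λ i → x ∈? ψ (es W i)

  uses? : ∀ (W : Walk ψ) e → Dec (∃ λ i → es W i ≡ e)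
  uses? W e = any? λ i → es W i ≟ e

  traversed : Walk ψ → Sub N m
  traversed W = comprehension (visits? W) , comprehension (uses? W)

  traversed-edge : ∀ W i → es W i ∈ ES (traversed W)
  traversed-edge W i = ∈-comprehension⁺ (uses? W) (i , refl)

  traversed-vertex : ∀ W i {x} → x ∈ ψ (es W i) → x ∈ VS (traversed W)
  traversed-vertex W i x∈ = ∈-comprehension⁺ (visits? W) (i , x∈)

  traversed-edge⁻ : ∀ W {e} → e ∈ ES (traversed W) → ∃ λ i → es W i ≡ e
  traversed-edge⁻ W = ∈-comprehension⁻ (uses? W)

  traversed-vertex⁻ : ∀ W {x} → x ∈ VS (traversed W) → ∃ λ i → x ∈ ψ (es W i)
  traversed-vertex⁻ W = ∈-comprehension⁻ (visits? W)

  traversed-hypersubgraph : ∀ W → Fin (len W) → IsHypersubgraph ψ (traversed W)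
  traversed-hypersubgraph W i = (vs W (inject₁ i) , traversed-vertex W i (vs∈es W i))
    , λ e e∈ → edge-closed (traversed-edge⁻ W e∈)
    where
    edge-closed : ∀ {e} → ∃ (λ i → es W i ≡ e) → ψ e ⊆ VS (traversed W)
    edge-closed (i , refl) = traversed-vertex W i

  traversed-nonempty-edges : ∀ W → NoEmptyEdges ψ (traversed W)
  traversed-nonempty-edges W e e∈ with traversed-edge⁻ W e∈
  ... | i , refl = vs W (inject₁ i) , vs∈es W i

  traversed-connected : ∀ W → Connected ψ (traversed W)
  traversed-connected W = Reach⇒Connected λ u∈ w∈ → Reach-trans (to-start u∈) (Reach-sym (to-start w∈))
    where
    to-start : ∀ {u} → u ∈ VS (traversed W) → Reach (ES (traversed W)) u (vs W zero)
    to-start u∈ with traversed-vertex⁻ W u∈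
    ... | i , u∈eᵢ = step (es W i) (traversed-edge W i) u∈eᵢ (vs∈es W i)
                       (Reach-sym (Walk⇒Reach W (traversed-edge W) (inject₁ i)))

  -- Going around the cycle one passes from K₂ to K₁ and back, each time at a vertex of both sides, i.e. at v;
  -- since the cycle visits v only once, both passages happen at the same index.
  closed-walk-no-separation : ∀ (C : Walk ψ) → vs C zero ≡ vs C (fromℕ (len C)) →
    (∀ i j → vs C (inject₁ i) ≡ vs C (inject₁ j) → i ≡ j) → ∀ {v K₁ K₂} → ¬ Separation (traversed C) v K₁ K₂
  closed-walk-no-separation C@record { len = zero } _ _ S
    with () ← proj₁ (traversed-edge⁻ C (edges₁⊆ S (proj₂ (edge₁ S))))
  closed-walk-no-separation C@record { len = suc k ; vs = f ; es = g } closed injective {v} {K₁} {K₂} S =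
    crossings (cyclic-boundary On₁? (proj₂ some-on₁) (proj₂ some-off₁))
              (cyclic-boundary (¬? ∘ On₁?) (proj₂ some-off₁) (λ ¬on₁ → ¬on₁ (proj₂ some-on₁)))
    where
    On₁ : Fin (suc k) → Set
    On₁ i = g i ∈ ES K₁
    On₁? : Decidable On₁
    On₁? i = g i ∈? ES K₁
    some-on₁ : ∃ On₁
    some-on₁ with traversed-edge⁻ C (edges₁⊆ S (proj₂ (edge₁ S)))
    ... | i , refl = i , proj₂ (edge₁ S)
    some-off₁ : ∃ λ i → ¬ On₁ i
    some-off₁ with traversed-edge⁻ C (edges₂⊆ S (proj₂ (edge₂ S)))
    ... | j , refl = j , λ on₁ → edges-disjoint S on₁ (proj₂ (edge₂ S))
    on₂ : ∀ {i} → ¬ On₁ i → g i ∈ ES K₂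
    on₂ {i} ¬on₁ = [ ⊥-elim ∘ ¬on₁ , id ]′ (edge-cover S (traversed-edge C i))
    leaves : ∀ i → f (inject₁ i) ∈ ψ (g i)
    leaves = vs∈es C
    enters : ∀ i → f (inject₁ i) ∈ ψ (g (prev i))
    enters zero = subst (_∈ ψ (g (fromℕ k))) (sym closed) (vs-suc∈es C (fromℕ k))
    enters (suc i) = vs-suc∈es C (inject₁ i)
    entry : ∀ {p} → On₁ p → ¬ On₁ (prev p) → f (inject₁ p) ≡ v
    entry {p} on₁ ¬on₁-before = meet-at-edges S on₁ (on₂ ¬on₁-before) (leaves p) (enters p)
    exit : ∀ {p} → ¬ On₁ p → ¬ ¬ On₁ (prev p) → f (inject₁ p) ≡ v
    exit {p} ¬on₁ ¬¬on₁-before =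
      meet-at-edges S (decidable-stable (On₁? (prev p)) ¬¬on₁-before) (on₂ ¬on₁) (enters p) (leaves p)
    crossings : (∃ λ p → On₁ p × ¬ On₁ (prev p)) → (∃ λ p → ¬ On₁ p × ¬ ¬ On₁ (prev p)) → ⊥
    crossings (p , on₁ , ¬on₁-before) (p′ , ¬on₁ , ¬¬on₁-before) =
      ¬on₁ (subst On₁ (injective p p′ (trans (entry on₁ ¬on₁-before) (sym (exit ¬on₁ ¬¬on₁-before))))
                  on₁)

  cycle-nonseparable : ∀ C → IsCycle ψ C → NonSeparable ψ (traversed C)
  cycle-nonseparable C (_ , closed , injective , _) =
    traversed-connected C , traversed-nonempty-edges C
    , λ v s → closed-walk-no-separation C closed injective (separation s)

  block-above : ∀ {K} → IsHypersubgraph ψ K → NonSeparable ψ K → ∃ λ B → IsBlock ψ B × K ⊑ B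
  block-above K-hs K-ns with maximal-above (λ K → IsHypersubgraph? K ×-dec NonSeparable? K) (K-hs , K-ns)
  ... | B , (B-hs , B-ns) , K⊑B , maximal =
    B , (B-hs , B-ns , λ L L-hs VB⊆VL EB⊆EL L-ns → maximal L (L-hs , L-ns) (VB⊆VL , EB⊆EL)) , K⊑B

  blocks-with-nonseparable-union-≡ : ∀ {B₁ B₂} → IsBlock ψ B₁ → IsBlock ψ B₂ →
    NonSeparable ψ (B₁ ∪ₛ B₂) → B₁ ≡ B₂
  blocks-with-nonseparable-union-≡ {B₁} {B₂} (hs₁ , _ , maximal₁) (hs₂ , _ , maximal₂) U-ns =
    ⊑-antisym (⊑-trans B₁⊑U (maximal₂ U U-hs (q⊆p∪q _ _) (q⊆p∪q _ _) U-ns))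
              (⊑-trans B₂⊑U (maximal₁ U U-hs (p⊆p∪q _) (p⊆p∪q _) U-ns))
    where
    U : Sub N m
    U = B₁ ∪ₛ B₂
    U-hs : IsHypersubgraph ψ U
    U-hs = ∪ₛ-hypersubgraph hs₁ hs₂
    B₁⊑U : B₁ ⊑ U
    B₁⊑U = p⊆p∪q _ , p⊆p∪q _
    B₂⊑U : B₂ ⊑ U
    B₂⊑U = q⊆p∪q _ _ , q⊆p∪q _ _

  blocks-sharing-edge-≡ : ∀ {B₁ B₂ e} → IsBlock ψ B₁ → IsBlock ψ B₂ → e ∈ ES B₁ → e ∈ ES B₂ → B₁ ≡ B₂
  blocks-sharing-edge-≡ bl₁@(hs₁ , ns₁ , _) bl₂@(hs₂ , ns₂ , _) e∈₁ e∈₂ =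
    blocks-with-nonseparable-union-≡ bl₁ bl₂ (∪ₛ-nonseparable-sharing-edge hs₁ ns₁ hs₂ ns₂ e∈₁ e∈₂)

  distinct-blocks-share-no-edge : ∀ {B₁ B₂} → IsBlock ψ B₁ → IsBlock ψ B₂ → B₁ ≢ B₂ → ES B₁ ∩ ES B₂ ≡ ∅
  distinct-blocks-share-no-edge bl₁ bl₂ B₁≢B₂ = Empty-unique λ (e , e∈) →
    B₁≢B₂ (blocks-sharing-edge-≡ bl₁ bl₂ (p∩q⊆p _ _ e∈) (p∩q⊆q _ _ e∈))

  distinct-blocks-share-≤1-vertex : ∀ {B₁ B₂} → IsBlock ψ B₁ → IsBlock ψ B₂ → B₁ ≢ B₂ →
    ∣ VS B₁ ∩ VS B₂ ∣ ≤ 1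
  distinct-blocks-share-≤1-vertex bl₁@(hs₁ , ns₁ , _) bl₂@(hs₂ , ns₂ , _) B₁≢B₂ = ∣p∣≤1 _ λ {x} {y} x∈ y∈ →
    decidable-stable (x ≟ y) λ x≢y → B₁≢B₂ (blocks-with-nonseparable-union-≡ bl₁ bl₂
      (∪ₛ-nonseparable-sharing-two-vertices hs₁ ns₁ hs₂ ns₂ x≢y
        (p∩q⊆p _ _ x∈) (p∩q⊆q _ _ x∈) (p∩q⊆p _ _ y∈) (p∩q⊆q _ _ y∈)))

  block-containing-vertex : ∀ v → ∃ λ B → IsBlock ψ B × v ∈ VS B
  block-containing-vertex v with block-above (vertex-sub-hypersubgraph v) (vertex-sub-nonseparable v)
  ... | B , bl , (v⊆B , _) = B , bl , v⊆B (x∈⁅x⁆ v)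

  block-containing-edge : ∀ {e} → Nonempty (ψ e) → ∃ λ B → IsBlock ψ B × e ∈ ES B
  block-containing-edge {e} e-nonempty
    with block-above (edge-sub-hypersubgraph e-nonempty) (edge-sub-nonseparable e-nonempty)
  ... | B , bl , (_ , e⊆B) = B , bl , e⊆B (x∈⁅x⁆ e)

  block-containing-cycle : ∀ C → IsCycle ψ C → ∃ λ B → IsBlock ψ B × CycleContainedIn ψ C B
  block-containing-cycle C C-cycle@(s≤s _ , _)
    with block-above (traversed-hypersubgraph C zero) (cycle-nonseparable C C-cycle)
  ... | B , bl@((_ , B-closed) , _) , (_ , EC⊆B) =
    B , bl , λ i → EC⊆B (traversed-edge C i) , B-closed _ (EC⊆B (traversed-edge C i))

theorem3p37 : ∀ {n m : ℕ} (ψ : Incidence (suc n) m) →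
    Connected ψ (⊤ , ⊤) → NoEmptyEdges ψ (⊤ , ⊤) →
    (∀ B₁ B₂ → IsBlock ψ B₁ → IsBlock ψ B₂ → B₁ ≢ B₂ →
      (ES B₁ ∩ ES B₂ ≡ ∅) × (∣ VS B₁ ∩ VS B₂ ∣ ≤ 1))
    × ((∀ v → Σ (Sub (suc n) m) λ B → IsBlock ψ B × (v ∈ VS B))
      × (∀ e → Σ (Sub (suc n) m) λ B → IsBlock ψ B × (e ∈ ES B))
      × (∀ e B₁ B₂ → IsBlock ψ B₁ → IsBlock ψ B₂ → e ∈ ES B₁ → e ∈ ES B₂ → B₁ ≡ B₂))
    × (∀ (C : Walk ψ) → IsCycle ψ C →
      Σ (Sub (suc n) m) λ B → IsBlock ψ B × CycleContainedIn ψ C B)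
theorem3p37 ψ _ no-empty-edges =
  (λ _ _ bl₁ bl₂ B₁≢B₂ →
     distinct-blocks-share-no-edge ψ bl₁ bl₂ B₁≢B₂ , distinct-blocks-share-≤1-vertex ψ bl₁ bl₂ B₁≢B₂)
  , (block-containing-vertex ψ
    , (λ e → block-containing-edge ψ (no-empty-edges e ∈⊤))
    , λ _ _ _ → blocks-sharing-edge-≡ ψ)
  , block-containing-cycle ψ
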